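{- Let $S = S(\lambda_1,\ldots,\lambda_d)$ be a spider with $d\ge 2$ legs, and let $S'$ be the spider with $d-1$ legs obtained from $S$ by replacing two legs, of lengths $\lambda_i$ and $\lambda_j$ ($i\neq j$), with a single leg of length $\lambda_i+\lambda_j$. If $S$ has a connected partition of type $\mu$, then $S'$ has a connected partition of type $\mu$ as well.
   Context: For positive integers $\lambda_1,\ldots,\lambda_d$, the spider $S(\lambda_1,\ldots,\lambda_d)$ is the tree consisting of a center vertex $v$ together with $d$ paths ("legs") having $\lambda_1,\ldots,\lambda_d$ vertices respectively, each attached to $v$ by an edge at one of its endpoints. A connected partition of an $n$-vertex graph is a partition of its vertex set into sets each inducing a connected subgraph; its type is the integer partition of $n$ formed by the sizes of the sets. -}

module Defs where

open import Data.Nat using (ℕ; zero; suc; _+_; _≤_)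
open import Data.Fin using (Fin; toℕ; punchOut)
open import Data.Vec using (Vec; lookup; removeAt; _∷_)
open import Data.List using (List; []; map; concatMap; allFin; concat; length)
open import Data.List.Membership.Propositional using (_∈_)
open import Data.List.Relation.Binary.Permutation.Propositional using (_↭_)
open import Data.Product using (Σ; _×_; _,_)
open import Data.Sum using (_⊎_)
open import Relation.Binary.PropositionalEquality using (_≡_; _≢_)

-- A spider is given by its leg lengths  lam = (λ₁,…,λ_d) : Vec ℕ d.
-- Vertices: the center, and for each leg k the vertices (k , p), p < λ_k,
-- where (k , 0) is the leg endpoint attached to the center.
data Vertex {d : ℕ} (lam : Vec ℕ d) : Set where
  center : Vertex lam
  leg    : (k : Fin d) → Fin (lookup lam k) → Vertex lam

data Edge {d : ℕ} (lam : Vec ℕ d) : Vertex lam → Vertex lam → Set where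
  hub  : (k : Fin d) (p : Fin (lookup lam k)) → toℕ p ≡ 0 →
         Edge lam center (leg k p)
  step : (k : Fin d) (p q : Fin (lookup lam k)) → toℕ q ≡ suc (toℕ p) →
         Edge lam (leg k p) (leg k q)

Adj : {d : ℕ} (lam : Vec ℕ d) → Vertex lam → Vertex lam → Set
Adj lam u v = Edge lam u v ⊎ Edge lam v u

vertices : {d : ℕ} (lam : Vec ℕ d) → List (Vertex lam)
vertices {d} lam = center ∷' concatMap (λ k → map (leg k) (allFin (lookup lam k))) (allFin d)
  where
  open import Data.List using () renaming (_∷_ to _∷'_)

data WalkIn {d : ℕ} (lam : Vec ℕ d) (B : List (Vertex lam)) :
            Vertex lam → Vertex lam → Set where
  here  : ∀ {u} → WalkIn lam B u u
  there : ∀ {u w v} → Adj lam u w → w ∈ B → WalkIn lam B w v → WalkIn lam B u v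

InducesConnected : {d : ℕ} (lam : Vec ℕ d) → List (Vertex lam) → Set
InducesConnected lam B =
  (B ≢ []) × (∀ u v → u ∈ B → v ∈ B → WalkIn lam B u v)

record ConnectedPartition {d : ℕ} (lam : Vec ℕ d) : Set where
  field
    blocks    : List (List (Vertex lam))
    partition : concat blocks ↭ vertices lam
    connected : ∀ B → B ∈ blocks → InducesConnected lam B

partType : {d : ℕ} {lam : Vec ℕ d} → ConnectedPartition lam → List ℕ
partType P = map length (ConnectedPartition.blocks P)

-- S(lam) has a connected partition of type μ (μ a multiset, i.e. list up to permutation).
HasCPOfType : {d : ℕ} (lam : Vec ℕ d) → List ℕ → Set
HasCPOfType lam μ = Σ (ConnectedPartition lam) (λ P → partType P ↭ μ)

PositiveLegs : {d : ℕ} → Vec ℕ d → Set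
PositiveLegs {d} lam = (k : Fin d) → 1 ≤ lookup lam k

mergeLegs : {e : ℕ} (lam : Vec ℕ (suc (suc e))) (i j : Fin (suc (suc e))) →
            i ≢ j → Vec ℕ (suc e)
mergeLegs lam i j i≢j = (lookup lam i + lookup lam j) ∷ removeAt (removeAt lam i) (punchOut i≢j)

-- Let C be the block containing the center, and call the longest initial segment of a leg lying in C
-- its head. Bring the two legs to be merged to the front (a graph isomorphism), and lay out the merged
-- leg as: head of the first leg, head of the second leg, rest of the first leg, rest of the second leg.
-- Under this bijection of vertices every block stays connected: an edge inside a block either remains
-- an edge, or is the edge from the center to the second head, which becomes a path through the first
-- head inside C. Consecutive leg vertices across the end of a head are never in a common block, since
-- the first lies in C and the second does not. So the blocks, with their sizes, carry over.
module Submission where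

open import Defs
open import Data.Nat using (ℕ; zero; suc; _+_; _∸_; _≤_; _<_; z≤n; s≤s; _<?_)
open import Data.Nat.Properties
open import Data.Fin as Fin using (Fin; toℕ; fromℕ<; cast; punchIn; punchOut)
open import Data.Fin.Patterns using (0F; 1F)
open import Data.Fin.Properties
  using (toℕ-injective; toℕ<n; toℕ-fromℕ<; toℕ-cast; punchIn-punchOut; punchOut-punchIn; punchInᵢ≢i)
open import Data.Fin.Permutation as Permutation using (Permutation; _⟨$⟩ʳ_; _⟨$⟩ˡ_; inverseʳ; inverseˡ)
open import Data.Vec using (Vec; lookup; removeAt; _∷_)
open import Data.Vec.Properties using (removeAt-punchOut)
open import Data.List using (List; []; _∷_; map; concat; allFin; length)
open import Data.List.Membership.Propositional using (_∈_)
open import Data.List.Membership.Propositional.Properties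
  using (∈-map⁺; ∈-map⁻; ∈-allFin; ∈-concat⁺′; ∈-concat⁻′; concat-∈↔)
open import Data.List.Membership.Propositional.Properties.WithK using (unique⇒irrelevant; unique∧set⇒bag)
import Data.List.Membership.DecPropositional as DecMembership
open import Data.List.Relation.Binary.BagAndSetEquality using (∼bag⇒↭)
open import Data.List.Relation.Binary.Permutation.Propositional using (_↭_; ↭-sym; ↭-trans; ↭⇒↭ₛ)
import Data.List.Relation.Binary.Permutation.Propositional.Properties as Perm
import Data.List.Relation.Binary.Permutation.Setoid.Properties as PermSetoid
open import Data.List.Relation.Unary.Unique.Propositional using (Unique)
import Data.List.Relation.Unary.Unique.Propositional.Properties as Unique
import Data.List.Relation.Unary.All as All
import Data.List.Relation.Unary.All.Properties as All
import Data.List.Relation.Unary.AllPairs as AllPairs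
import Data.List.Relation.Unary.AllPairs.Properties as AllPairs
open import Data.List.Relation.Unary.Any using (here; there)
open import Data.List.Properties using (concat-map; map-∘; map-cong; length-map)
open import Data.Product using (∃; _×_; _,_; proj₁; proj₂)
open import Data.Sum using (_⊎_; inj₁; inj₂; swap)
open import Data.Empty using (⊥; ⊥-elim)
open import Relation.Nullary using (¬_; yes; no; contradiction)
open import Relation.Unary using (Decidable)
open import Relation.Binary.Definitions using (DecidableEquality)
open import Relation.Binary.PropositionalEquality
open import Function using (_∘_; _↔_; Inverse; mk↔ₛ′; mk⇔)

module _ {d : ℕ} {lam : Vec ℕ d} where

  leg-cong : ∀ {k k'} {p : Fin (lookup lam k)} {p' : Fin (lookup lam k')} →
             k ≡ k' → toℕ p ≡ toℕ p' → leg {lam = lam} k p ≡ leg k' p'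
  leg-cong refl p≡p' = cong (leg _) (toℕ-injective p≡p')

  _≟ᵥ_ : DecidableEquality (Vertex lam)
  center  ≟ᵥ center   = yes refl
  center  ≟ᵥ leg _ _  = no λ ()
  leg _ _ ≟ᵥ center   = no λ ()
  leg k p ≟ᵥ leg k' p' with k Fin.≟ k'
  ... | no k≢k' = no λ { refl → k≢k' refl }
  ... | yes refl with p Fin.≟ p'
  ...   | yes refl = yes refl
  ...   | no p≢p' = no λ { refl → p≢p' refl }

  legVertices : Fin d → List (Vertex lam)
  legVertices k = map (leg k) (allFin (lookup lam k))

  ∈-vertices : ∀ v → v ∈ vertices lam
  ∈-vertices center    = here refl
  ∈-vertices (leg k p) =
    there (∈-concat⁺′ (∈-map⁺ (leg k) (∈-allFin p)) (∈-map⁺ legVertices (∈-allFin k)))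

  vertices-unique : Unique (vertices lam)
  vertices-unique = All.tabulate center∉legs AllPairs.∷
    Unique.concat⁺ (All.map⁺ (All.tabulate λ _ → Unique.map⁺ (λ { refl → refl }) (Unique.allFin⁺ _)))
                   (AllPairs.map⁺ (AllPairs.map legs-disjoint (Unique.allFin⁺ d)))
    where
    center∉legs : ∀ {v} → v ∈ concat (map legVertices (allFin d)) → center ≢ v
    center∉legs v∈ refl with ∈-concat⁻′ (map legVertices (allFin d)) v∈
    ... | _ , center∈vs , vs∈ with ∈-map⁻ legVertices vs∈
    ...   | k , _ , refl with ∈-map⁻ (leg k) center∈vs
    ...     | _ , _ , ()
    legs-disjoint : ∀ {k k'} → k ≢ k' → ∀ {v} → v ∈ legVertices k × v ∈ legVertices k' → ⊥
    legs-disjoint k≢k' (v∈k , v∈k') with ∈-map⁻ _ v∈k | ∈-map⁻ _ v∈k'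
    ... | _ , _ , refl | _ , _ , refl = k≢k' refl

map-vertices-↭ : ∀ {d d'} {lam : Vec ℕ d} {lam' : Vec ℕ d'} (f : Vertex lam ↔ Vertex lam') →
                 map (Inverse.to f) (vertices lam) ↭ vertices lam'
map-vertices-↭ f =
  ∼bag⇒↭ (unique∧set⇒bag (Unique.map⁺ to-injective vertices-unique) vertices-unique
           (λ {v} → mk⇔ (λ _ → ∈-vertices v)
                        (λ _ → subst (_∈ _) (strictlyInverseˡ v) (∈-map⁺ to (∈-vertices (from v))))))
  where
  open Inverse f
  to-injective : ∀ {u v} → to u ≡ to v → u ≡ v
  to-injective {u} {v} eq = trans (sym (strictlyInverseʳ u)) (trans (cong from eq) (strictlyInverseʳ v))

module _ {d : ℕ} {lam : Vec ℕ d} {B : List (Vertex lam)} where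

  _++ʷ_ : ∀ {u v w} → WalkIn lam B u v → WalkIn lam B v w → WalkIn lam B u w
  here         ++ʷ q = q
  there e v∈ p ++ʷ q = there e v∈ (p ++ʷ q)

  reverseʷ : ∀ {u v} → u ∈ B → WalkIn lam B u v → WalkIn lam B v u
  reverseʷ u∈ here           = here
  reverseʷ u∈ (there e w∈ p) = reverseʷ w∈ p ++ʷ there (swap e) u∈ here

  edgeʷ : ∀ {u v} → Edge lam u v → v ∈ B → WalkIn lam B u v
  edgeʷ e v∈ = there (inj₁ e) v∈ here

module _ {d : ℕ} {lam : Vec ℕ d} (P : ConnectedPartition lam) where
  open ConnectedPartition P

  -- Membership in the duplicate-free list concat blocks has a unique proof, and that proof determines the block.
  block-unique : ∀ {B C v} → B ∈ blocks → C ∈ blocks → v ∈ B → v ∈ C → B ≡ C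
  block-unique {B} {C} B∈ C∈ v∈B v∈C = cong proj₁ (begin
    B , v∈B , B∈             ≡⟨ strictlyInverseʳ _ ⟨
    from (to (B , v∈B , B∈)) ≡⟨ cong from (unique⇒irrelevant concat-unique _ _) ⟩
    from (to (C , v∈C , C∈)) ≡⟨ strictlyInverseʳ _ ⟩
    C , v∈C , C∈             ∎)
    where
    open Inverse concat-∈↔
    open ≡-Reasoning
    concat-unique : Unique (concat blocks)
    concat-unique = PermSetoid.Unique-resp-↭ (setoid _) (↭⇒↭ₛ (↭-sym partition)) vertices-unique

BlockEdgesToWalks : ∀ {d d'} {lam : Vec ℕ d} {lam' : Vec ℕ d'} →
                    (Vertex lam → Vertex lam') → ConnectedPartition lam → Set
BlockEdgesToWalks {lam = lam} {lam'} f P = ∀ {B u w} → B ∈ ConnectedPartition.blocks P →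
  u ∈ B → w ∈ B → Edge lam u w → WalkIn lam' (map f B) (f u) (f w)

module _ {d d'} {lam : Vec ℕ d} {lam' : Vec ℕ d'} (f : Vertex lam ↔ Vertex lam')
         (P : ConnectedPartition lam) (edge-walk : BlockEdgesToWalks (Inverse.to f) P) where
  open Inverse f using (to)
  open ConnectedPartition P

  private
    walk-image : ∀ {B u v} → B ∈ blocks → u ∈ B → WalkIn lam B u v → WalkIn lam' (map to B) (to u) (to v)
    walk-image B∈ u∈ here                  = here
    walk-image B∈ u∈ (there (inj₁ e) w∈ p) = edge-walk B∈ u∈ w∈ e ++ʷ walk-image B∈ w∈ p
    walk-image B∈ u∈ (there (inj₂ e) w∈ p) =
      reverseʷ (∈-map⁺ to w∈) (edge-walk B∈ w∈ u∈ e) ++ʷ walk-image B∈ w∈ p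

    nonempty-image : ∀ {B} → B ≢ [] → map to B ≢ []
    nonempty-image {[]}    B≢[] = ⊥-elim (B≢[] refl)
    nonempty-image {_ ∷ _} _    ()

    image-connected : ∀ {B} → B ∈ blocks → InducesConnected lam' (map to B)
    image-connected {B} B∈ = nonempty-image (proj₁ (connected B B∈)) , walk
      where
      walk : ∀ u v → u ∈ map to B → v ∈ map to B → WalkIn lam' (map to B) u v
      walk _ _ u∈ v∈ with ∈-map⁻ to u∈ | ∈-map⁻ to v∈
      ... | u , u∈B , refl | v , v∈B , refl = walk-image B∈ u∈B (proj₂ (connected B B∈) u v u∈B v∈B)

  relabel : ∀ {μ} → partType P ↭ μ → HasCPOfType lam' μ
  relabel P↭μ = record
    { blocks    = map (map to) blocks
    ; partition = subst (_↭ vertices lam') (sym (concat-map blocks))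
                        (↭-trans (Perm.map⁺ to partition) (map-vertices-↭ f))
    ; connected = connected′
    } , subst (_↭ _) (sym sizes) P↭μ
    where
    connected′ : ∀ B' → B' ∈ map (map to) blocks → InducesConnected lam' B'
    connected′ _ B'∈ with ∈-map⁻ (map to) B'∈
    ... | B , B∈ , refl = image-connected B∈
    sizes : map length (map (map to) blocks) ≡ map length blocks
    sizes = trans (sym (map-∘ blocks)) (map-cong (length-map to) blocks)

module _ {d d'} {lam : Vec ℕ d} {lam' : Vec ℕ d'} (π : Permutation d' d)
         (lookup-π : ∀ k → lookup lam' k ≡ lookup lam (π ⟨$⟩ʳ k)) where

  private
    lookup-π⁻¹ : ∀ k → lookup lam k ≡ lookup lam' (π ⟨$⟩ˡ k)
    lookup-π⁻¹ k = sym (trans (lookup-π (π ⟨$⟩ˡ k)) (cong (lookup lam) (inverseʳ π)))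

    to : Vertex lam → Vertex lam'
    to center    = center
    to (leg k p) = leg (π ⟨$⟩ˡ k) (cast (lookup-π⁻¹ k) p)

    from : Vertex lam' → Vertex lam
    from center    = center
    from (leg k p) = leg (π ⟨$⟩ʳ k) (cast (lookup-π k) p)

    legs-permuted : Vertex lam ↔ Vertex lam'
    legs-permuted = mk↔ₛ′ to from to-from from-to
      where
      to-from : ∀ v → to (from v) ≡ v
      to-from center    = refl
      to-from (leg k p) =
        leg-cong (inverseˡ π) (trans (toℕ-cast _ (cast (lookup-π k) p)) (toℕ-cast _ p))
      from-to : ∀ v → from (to v) ≡ v
      from-to center    = refl
      from-to (leg k p) =
        leg-cong (inverseʳ π) (trans (toℕ-cast _ (cast (lookup-π⁻¹ k) p)) (toℕ-cast _ p))

    to-edge : ∀ {u v} → Edge lam u v → Edge lam' (to u) (to v)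
    to-edge (hub k p p≡0)      = hub _ _ (trans (toℕ-cast _ p) p≡0)
    to-edge (step k p q q≡1+p) =
      step _ _ _ (trans (toℕ-cast _ q) (trans q≡1+p (cong suc (sym (toℕ-cast _ p)))))

  permuteLegs : ∀ {μ} → HasCPOfType lam μ → HasCPOfType lam' μ
  permuteLegs (P , P↭μ) =
    relabel legs-permuted P (λ _ _ w∈ e → edgeʷ (to-edge e) (∈-map⁺ to w∈)) P↭μ

lookup-removeAt : ∀ {A : Set} {n} (xs : Vec A (suc n)) i k →
                  lookup (removeAt xs i) k ≡ lookup xs (punchIn i k)
lookup-removeAt xs i k =
  trans (cong (lookup (removeAt xs i)) (sym (punchOut-punchIn i))) (removeAt-punchOut xs (punchInᵢ≢i i k ∘ sym))

module _ {e} (lam : Vec ℕ (suc (suc e))) {i j : Fin (suc (suc e))} (i≢j : i ≢ j) where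

  legsToFront : Permutation (suc (suc e)) (suc (suc e))
  legsToFront = Permutation.insert 0F i (Permutation.insert 0F (punchOut i≢j) Permutation.id)

  lookup-legsToFront : ∀ k → lookup (lookup lam i ∷ lookup lam j ∷ removeAt (removeAt lam i) (punchOut i≢j)) k
                             ≡ lookup lam (legsToFront ⟨$⟩ʳ k)
  lookup-legsToFront 0F                    = refl
  lookup-legsToFront 1F                    = cong (lookup lam) (sym (punchIn-punchOut i≢j))
  lookup-legsToFront (Fin.suc (Fin.suc k)) =
    trans (lookup-removeAt (removeAt lam i) _ k) (lookup-removeAt lam i _)

record MaximalPrefix {m : ℕ} (Q : Fin m → Set) : Set where
  field
    size   : ℕ
    size≤m : size ≤ m
    inside : ∀ p → toℕ p < size → Q p
    stops  : ∀ p → toℕ p ≡ size → ¬ Q p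

  member≤⇒< : ∀ {p} → Q p → toℕ p ≤ size → toℕ p < size
  member≤⇒< {p} Qp p≤ with m≤n⇒m<n∨m≡n p≤
  ... | inj₁ p< = p<
  ... | inj₂ p≡ = contradiction Qp (stops p p≡)

maximalPrefix : ∀ {m} {Q : Fin m → Set} → Decidable Q → MaximalPrefix Q
maximalPrefix {zero} Q? = record { size = 0 ; size≤m = z≤n ; inside = λ () ; stops = λ () }
maximalPrefix {suc m} Q? with Q? Fin.zero
... | no ¬Q0 = record { size = 0 ; size≤m = z≤n ; inside = λ _ () ; stops = λ { Fin.zero _ → ¬Q0 } }
... | yes Q0 = record
  { size   = suc size
  ; size≤m = s≤s size≤m
  ; inside = λ { Fin.zero _ → Q0 ; (Fin.suc p) (s≤s p<) → inside p p< }
  ; stops  = λ { (Fin.suc p) p≡ → stops p (suc-injective p≡) }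
  }
  where open MaximalPrefix (maximalPrefix (Q? ∘ Fin.suc))

n≤m⇒m<n+o⇒m∸n<o : ∀ {m n o} → n ≤ m → m < n + o → m ∸ n < o
n≤m⇒m<n+o⇒m∸n<o {n = n} n≤m m<n+o = +-cancelˡ-< n _ _ (subst (_< n + _) (sym (m+[n∸m]≡n n≤m)) m<n+o)

module LegShuffle {a b α β : ℕ} (α≤a : α ≤ a) (β≤b : β ≤ b) where

  data Placed : Fin a ⊎ Fin b → ℕ → Set where
    headˡ : ∀ {p} → toℕ p < α → Placed (inj₁ p) (toℕ p)
    headʳ : ∀ {q} → toℕ q < β → Placed (inj₂ q) (α + toℕ q)
    tailˡ : ∀ {p} → α ≤ toℕ p → Placed (inj₁ p) (β + toℕ p)
    tailʳ : ∀ {q} → β ≤ toℕ q → Placed (inj₂ q) (a + toℕ q)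

  placed-< : ∀ {x n} → Placed x n → n < a + b
  placed-< (headˡ {p} _) = <-≤-trans (toℕ<n p) (m≤m+n a b)
  placed-< (headʳ {q} _) = +-mono-≤-< α≤a (toℕ<n q)
  placed-< (tailˡ {p} _) = <-≤-trans (+-mono-≤-< β≤b (toℕ<n p)) (≤-reflexive (+-comm b a))
  placed-< (tailʳ {q} _) = +-monoʳ-< a (toℕ<n q)

  placed-functional : ∀ {x m n} → Placed x m → Placed x n → m ≡ n
  placed-functional (headˡ _)   (headˡ _)   = refl
  placed-functional (headˡ p<α) (tailˡ α≤p) = contradiction p<α (≤⇒≯ α≤p)
  placed-functional (tailˡ α≤p) (headˡ p<α) = contradiction p<α (≤⇒≯ α≤p)
  placed-functional (tailˡ _)   (tailˡ _)   = refl
  placed-functional (headʳ _)   (headʳ _)   = refl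
  placed-functional (headʳ q<β) (tailʳ β≤q) = contradiction q<β (≤⇒≯ β≤q)
  placed-functional (tailʳ β≤q) (headʳ q<β) = contradiction q<β (≤⇒≯ β≤q)
  placed-functional (tailʳ _)   (tailʳ _)   = refl

  placement : ∀ x → ∃ (Placed x)
  placement (inj₁ p) with toℕ p <? α
  ... | yes p<α = _ , headˡ p<α
  ... | no  p≮α = _ , tailˡ (≮⇒≥ p≮α)
  placement (inj₂ q) with toℕ q <? β
  ... | yes q<β = _ , headʳ q<β
  ... | no  q≮β = _ , tailʳ (≮⇒≥ q≮β)

  -- Opaque, so that a `with` on `toℕ p <? α` does not also abstract the test inside `shuffle`.
  opaque
    shuffle : Fin a ⊎ Fin b → Fin (a + b)
    shuffle x = fromℕ< (placed-< (proj₂ (placement x)))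

    toℕ-shuffle : ∀ {x n} → Placed x n → toℕ (shuffle x) ≡ n
    toℕ-shuffle {x} x↦n = trans (toℕ-fromℕ< _) (placed-functional (proj₂ (placement x)) x↦n)

  unshuffleℕ : ∀ n → n < a + b → Fin a ⊎ Fin b
  unshuffleℕ n n<a+b with n <? α | n <? α + β | n <? a + β
  ... | yes n<α | _ | _ = inj₁ (fromℕ< (<-≤-trans n<α α≤a))
  ... | no n≮α | yes n<α+β | _ = inj₂ (fromℕ< (<-≤-trans (n≤m⇒m<n+o⇒m∸n<o (≮⇒≥ n≮α) n<α+β) β≤b))
  ... | no _ | no n≮α+β | yes n<a+β =
    inj₁ (fromℕ< (n≤m⇒m<n+o⇒m∸n<o (m+n≤o⇒n≤o α (≮⇒≥ n≮α+β)) (subst (n <_) (+-comm a β) n<a+β)))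
  ... | no _ | no _ | no n≮a+β = inj₂ (fromℕ< (n≤m⇒m<n+o⇒m∸n<o (m+n≤o⇒m≤o a (≮⇒≥ n≮a+β)) n<a+b))

  unshuffle : Fin (a + b) → Fin a ⊎ Fin b
  unshuffle m = unshuffleℕ (toℕ m) (toℕ<n m)

  placed-unshuffleℕ : ∀ n (n<a+b : n < a + b) → Placed (unshuffleℕ n n<a+b) n
  placed-unshuffleℕ n n<a+b with n <? α | n <? α + β | n <? a + β
  ... | yes n<α | _ | _ =
    subst (Placed _) (toℕ-fromℕ< _) (headˡ (subst (_< α) (sym (toℕ-fromℕ< _)) n<α))
  ... | no n≮α | yes n<α+β | _ =
    subst (Placed _) (trans (cong (α +_) (toℕ-fromℕ< _)) (m+[n∸m]≡n (≮⇒≥ n≮α)))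
          (headʳ (subst (_< β) (sym (toℕ-fromℕ< _)) (n≤m⇒m<n+o⇒m∸n<o (≮⇒≥ n≮α) n<α+β)))
  ... | no _ | no n≮α+β | yes _ =
    subst (Placed _) (trans (cong (β +_) (toℕ-fromℕ< _)) (m+[n∸m]≡n (m+n≤o⇒n≤o α (≮⇒≥ n≮α+β))))
          (tailˡ (subst (α ≤_) (sym (toℕ-fromℕ< _)) (m+n≤o⇒m≤o∸n α (≮⇒≥ n≮α+β))))
  ... | no _ | no _ | no n≮a+β =
    subst (Placed _) (trans (cong (a +_) (toℕ-fromℕ< _)) (m+[n∸m]≡n (m+n≤o⇒m≤o a (≮⇒≥ n≮a+β))))
          (tailʳ (subst (β ≤_) (sym (toℕ-fromℕ< _))
                        (m+n≤o⇒m≤o∸n β (≤-trans (≤-reflexive (+-comm β a)) (≮⇒≥ n≮a+β)))))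

  unshuffleℕ-placed : ∀ {x n} → Placed x n → (n<a+b : n < a + b) → unshuffleℕ n n<a+b ≡ x
  unshuffleℕ-placed (headˡ {p} p<α) _ with toℕ p <? α
  ... | yes _   = cong inj₁ (toℕ-injective (toℕ-fromℕ< _))
  ... | no  p≮α = contradiction p<α p≮α
  unshuffleℕ-placed (headʳ {q} q<β) _ with α + toℕ q <? α | α + toℕ q <? α + β
  ... | yes α+q<α | _ = contradiction α+q<α (m+n≮m α _)
  ... | no _ | yes _ = cong inj₂ (toℕ-injective (trans (toℕ-fromℕ< _) (m+n∸m≡n α _)))
  ... | no _ | no α+q≮α+β = contradiction (+-monoʳ-< α q<β) α+q≮α+β
  unshuffleℕ-placed (tailˡ {p} α≤p) _ with β + toℕ p <? α | β + toℕ p <? α + β | β + toℕ p <? a + β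
  ... | yes β+p<α | _ | _ = contradiction β+p<α (≤⇒≯ (≤-trans α≤p (m≤n+m _ β)))
  ... | no _ | yes β+p<α+β | _ =
    contradiction β+p<α+β (≤⇒≯ (≤-trans (≤-reflexive (+-comm α β)) (+-monoʳ-≤ β α≤p)))
  ... | no _ | no _ | yes _ = cong inj₁ (toℕ-injective (trans (toℕ-fromℕ< _) (m+n∸m≡n β _)))
  ... | no _ | no _ | no β+p≮a+β =
    contradiction (<-≤-trans (+-monoʳ-< β (toℕ<n p)) (≤-reflexive (+-comm β a))) β+p≮a+β
  unshuffleℕ-placed (tailʳ {q} β≤q) _ with a + toℕ q <? α | a + toℕ q <? α + β | a + toℕ q <? a + β
  ... | yes a+q<α | _ | _ = contradiction a+q<α (≤⇒≯ (≤-trans α≤a (m≤m+n a _)))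
  ... | no _ | yes a+q<α+β | _ = contradiction a+q<α+β (≤⇒≯ (+-mono-≤ α≤a β≤q))
  ... | no _ | no _ | yes a+q<a+β = contradiction a+q<a+β (≤⇒≯ (+-monoʳ-≤ a β≤q))
  ... | no _ | no _ | no _ = cong inj₂ (toℕ-injective (trans (toℕ-fromℕ< _) (m+n∸m≡n a _)))

  placed-unshuffle : ∀ m → Placed (unshuffle m) (toℕ m)
  placed-unshuffle m = placed-unshuffleℕ (toℕ m) (toℕ<n m)

  shuffle-unshuffle : ∀ m → shuffle (unshuffle m) ≡ m
  shuffle-unshuffle m = toℕ-injective (toℕ-shuffle (placed-unshuffle m))

  unshuffle-placed : ∀ {x n} m → Placed x n → toℕ m ≡ n → unshuffle m ≡ x
  unshuffle-placed m x↦n refl = unshuffleℕ-placed x↦n (toℕ<n m)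

  unshuffle-shuffle : ∀ x → unshuffle (shuffle x) ≡ x
  unshuffle-shuffle x = unshuffle-placed (shuffle x) x↦n (toℕ-shuffle x↦n)
    where x↦n = proj₂ (placement x)

module _ {d : ℕ} {lam : Vec ℕ d} {B : List (Vertex lam)} where

  walk-from-center : ∀ k (X : Fin (lookup lam k)) → (∀ Y → toℕ Y ≤ toℕ X → leg k Y ∈ B) →
                     WalkIn lam B center (leg k X)
  walk-from-center k X below = go (toℕ X) X refl ≤-refl
    where
    go : ∀ n (Y : Fin (lookup lam k)) → toℕ Y ≡ n → n ≤ toℕ X → WalkIn lam B center (leg k Y)
    go zero    Y Y≡0   _   = edgeʷ (hub k Y Y≡0) (below Y (≤-trans (≤-reflexive Y≡0) z≤n))
    go (suc n) Y Y≡1+n 1+n≤X = go n Z (toℕ-fromℕ< _) (≤-trans (n≤1+n n) 1+n≤X)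
                               ++ʷ edgeʷ (step k Z Y (trans Y≡1+n (cong suc (sym (toℕ-fromℕ< _)))))
                                         (below Y (≤-trans (≤-reflexive Y≡1+n) 1+n≤X))
      where Z = fromℕ< (<-trans (n<1+n n) (subst (_< _) Y≡1+n (toℕ<n Y)))

module LegMerge {a b n : ℕ} {R : Vec ℕ n} {α β : ℕ} (α≤a : α ≤ a) (β≤b : β ≤ b) where
  open LegShuffle α≤a β≤b

  private
    side : Fin a ⊎ Fin b → Vertex (a ∷ b ∷ R)
    side (inj₁ p) = leg 0F p
    side (inj₂ q) = leg 1F q

  mergeVertex : Vertex (a ∷ b ∷ R) → Vertex (a + b ∷ R)
  mergeVertex center                        = center
  mergeVertex (leg 0F p)                    = leg 0F (shuffle (inj₁ p))
  mergeVertex (leg 1F q)                    = leg 0F (shuffle (inj₂ q))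
  mergeVertex (leg (Fin.suc (Fin.suc k)) r) = leg (Fin.suc k) r

  splitVertex : Vertex (a + b ∷ R) → Vertex (a ∷ b ∷ R)
  splitVertex center              = center
  splitVertex (leg 0F m)          = side (unshuffle m)
  splitVertex (leg (Fin.suc k) r) = leg (Fin.suc (Fin.suc k)) r

  merge↔ : Vertex (a ∷ b ∷ R) ↔ Vertex (a + b ∷ R)
  merge↔ = mk↔ₛ′ mergeVertex splitVertex merge-split split-merge
    where
    merge-side : ∀ x → mergeVertex (side x) ≡ leg 0F (shuffle x)
    merge-side (inj₁ _) = refl
    merge-side (inj₂ _) = refl
    merge-split : ∀ v → mergeVertex (splitVertex v) ≡ v
    merge-split center              = refl
    merge-split (leg 0F m)          = trans (merge-side (unshuffle m)) (cong (leg 0F) (shuffle-unshuffle m))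
    merge-split (leg (Fin.suc k) r) = refl
    split-merge : ∀ v → splitVertex (mergeVertex v) ≡ v
    split-merge center                        = refl
    split-merge (leg 0F p)                    = cong side (unshuffle-shuffle (inj₁ p))
    split-merge (leg 1F q)                    = cong side (unshuffle-shuffle (inj₂ q))
    split-merge (leg (Fin.suc (Fin.suc k)) r) = refl

  shuffle-edge : ∀ {x y n} → Placed x n → Placed y (suc n) →
                 Edge (a + b ∷ R) (leg 0F (shuffle x)) (leg 0F (shuffle y))
  shuffle-edge x↦n y↦1+n = step 0F _ _ (trans (toℕ-shuffle y↦1+n) (cong suc (sym (toℕ-shuffle x↦n))))

private module CenterBlock {a b n : ℕ} {R : Vec ℕ n} (P : ConnectedPartition (a ∷ b ∷ R)) where
  open ConnectedPartition P
  open DecMembership (_≟ᵥ_ {lam = a ∷ b ∷ R}) using (_∈?_)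

  centerBlock : ∃ λ C → center ∈ C × C ∈ blocks
  centerBlock = ∈-concat⁻′ blocks (Perm.∈-resp-↭ (↭-sym partition) (∈-vertices center))

  C : List (Vertex (a ∷ b ∷ R))
  C = proj₁ centerBlock

  center∈C : center ∈ C
  center∈C = proj₁ (proj₂ centerBlock)

  C∈blocks : C ∈ blocks
  C∈blocks = proj₂ (proj₂ centerBlock)

  module Headˡ = MaximalPrefix (maximalPrefix (λ p → leg 0F p ∈? C))
  module Headʳ = MaximalPrefix (maximalPrefix (λ q → leg 1F q ∈? C))

  α = Headˡ.size
  β = Headʳ.size

  open LegShuffle Headˡ.size≤m Headʳ.size≤m
  open LegMerge {R = R} Headˡ.size≤m Headʳ.size≤m public

  head∈C : ∀ {x n} → Placed x n → n < α + β → leg 0F (shuffle x) ∈ map mergeVertex C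
  head∈C (headˡ {p} p<α) _ = ∈-map⁺ mergeVertex (Headˡ.inside p p<α)
  head∈C (headʳ {q} q<β) _ = ∈-map⁺ mergeVertex (Headʳ.inside q q<β)
  head∈C (tailˡ α≤p) β+p<α+β =
    contradiction β+p<α+β (≤⇒≯ (≤-trans (≤-reflexive (+-comm α β)) (+-monoʳ-≤ β α≤p)))
  head∈C (tailʳ β≤q) a+q<α+β = contradiction a+q<α+β (≤⇒≯ (+-mono-≤ Headˡ.size≤m β≤q))

  front∈C : ∀ Y → toℕ Y < α + β → leg 0F Y ∈ map mergeVertex C
  front∈C Y Y<α+β = subst (λ Z → leg 0F Z ∈ map mergeVertex C) (shuffle-unshuffle Y)
                          (head∈C (placed-unshuffle Y) Y<α+β)

  stepˡ-walk : ∀ {B p q} → B ∈ blocks → leg 0F p ∈ B → leg 0F q ∈ B → toℕ q ≡ suc (toℕ p) →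
               WalkIn (a + b ∷ R) (map mergeVertex B) (mergeVertex (leg 0F p)) (mergeVertex (leg 0F q))
  stepˡ-walk {p = p} {q} B∈ p∈ q∈ q≡1+p with toℕ p <? α | toℕ q <? α
  ... | yes p<α | yes q<α =
    edgeʷ (shuffle-edge (headˡ p<α) (subst (Placed _) q≡1+p (headˡ q<α))) (∈-map⁺ mergeVertex q∈)
  ... | no p≮α | no q≮α =
    edgeʷ (shuffle-edge (tailˡ (≮⇒≥ p≮α)) (subst (Placed _) (trans (cong (β +_) q≡1+p) (+-suc β _))
                                                 (tailˡ (≮⇒≥ q≮α))))
          (∈-map⁺ mergeVertex q∈)
  ... | no p≮α | yes q<α = contradiction (<-trans (n<1+n _) (subst (_< α) q≡1+p q<α)) p≮α
  ... | yes p<α | no q≮α with block-unique P B∈ C∈blocks p∈ (Headˡ.inside p p<α)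
  ...   | refl = contradiction (Headˡ.member≤⇒< q∈ (subst (_≤ α) (sym q≡1+p) p<α)) q≮α

  stepʳ-walk : ∀ {B p q} → B ∈ blocks → leg 1F p ∈ B → leg 1F q ∈ B → toℕ q ≡ suc (toℕ p) →
               WalkIn (a + b ∷ R) (map mergeVertex B) (mergeVertex (leg 1F p)) (mergeVertex (leg 1F q))
  stepʳ-walk {p = p} {q} B∈ p∈ q∈ q≡1+p with toℕ p <? β | toℕ q <? β
  ... | yes p<β | yes q<β =
    edgeʷ (shuffle-edge (headʳ p<β) (subst (Placed _) (trans (cong (α +_) q≡1+p) (+-suc α _)) (headʳ q<β)))
          (∈-map⁺ mergeVertex q∈)
  ... | no p≮β | no q≮β =
    edgeʷ (shuffle-edge (tailʳ (≮⇒≥ p≮β)) (subst (Placed _) (trans (cong (a +_) q≡1+p) (+-suc a _))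
                                                 (tailʳ (≮⇒≥ q≮β))))
          (∈-map⁺ mergeVertex q∈)
  ... | no p≮β | yes q<β = contradiction (<-trans (n<1+n _) (subst (_< β) q≡1+p q<β)) p≮β
  ... | yes p<β | no q≮β with block-unique P B∈ C∈blocks p∈ (Headʳ.inside p p<β)
  ...   | refl = contradiction (Headʳ.member≤⇒< q∈ (subst (_≤ β) (sym q≡1+p) p<β)) q≮β

  edge-walk : BlockEdgesToWalks mergeVertex P
  edge-walk B∈ u∈ w∈ (hub 0F p p≡0) with block-unique P B∈ C∈blocks u∈ center∈C
  ... | refl = edgeʷ (hub 0F _ (trans (toℕ-shuffle (headˡ p<α)) p≡0)) (∈-map⁺ mergeVertex w∈)
    where p<α = Headˡ.member≤⇒< w∈ (subst (_≤ α) (sym p≡0) z≤n)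
  edge-walk B∈ u∈ w∈ (hub 1F q q≡0) with block-unique P B∈ C∈blocks u∈ center∈C
  ... | refl = walk-from-center 0F (shuffle (inj₂ q)) λ Y Y≤q → front∈C Y (≤-<-trans Y≤q q<α+β)
    where
    q<β = Headʳ.member≤⇒< w∈ (subst (_≤ β) (sym q≡0) z≤n)
    q<α+β = subst (_< α + β) (sym (toℕ-shuffle (headʳ q<β))) (+-monoʳ-< α q<β)
  edge-walk B∈ u∈ w∈ (hub (Fin.suc (Fin.suc k)) r r≡0) =
    edgeʷ (hub (Fin.suc k) r r≡0) (∈-map⁺ mergeVertex w∈)
  edge-walk B∈ u∈ w∈ (step 0F p q q≡1+p) = stepˡ-walk B∈ u∈ w∈ q≡1+p
  edge-walk B∈ u∈ w∈ (step 1F p q q≡1+p) = stepʳ-walk B∈ u∈ w∈ q≡1+p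
  edge-walk B∈ u∈ w∈ (step (Fin.suc (Fin.suc k)) p q q≡1+p) =
    edgeʷ (step (Fin.suc k) p q q≡1+p) (∈-map⁺ mergeVertex w∈)

mergeFirstLegs : ∀ {a b n} {R : Vec ℕ n} {μ} → HasCPOfType (a ∷ b ∷ R) μ → HasCPOfType (a + b ∷ R) μ
mergeFirstLegs (P , P↭μ) = relabel merge↔ P edge-walk P↭μ
  where open CenterBlock P

proposition6p6 : (e : ℕ) (lam : Vec ℕ (suc (suc e))) → PositiveLegs lam →
    (i j : Fin (suc (suc e))) (i≢j : i ≢ j) (μ : List ℕ) →
    HasCPOfType lam μ → HasCPOfType (mergeLegs lam i j i≢j) μ
proposition6p6 _ lam _ _ _ i≢j _ =
  mergeFirstLegs ∘ permuteLegs (legsToFront lam i≢j) (lookup-legsToFront lam i≢j)
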